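{- Let $(K_2,\sigma)$ be a signed edge $uv$ and let $L$ be a list assignment where $L(u)$ is a neighbored $5$-set and $L(v)$ is either $C^+$ or $C^-$. Then there exist $c_u\in L(u)$ and a $4$-element subset $L'(v)\subseteq L(v)$ such that for every $c_v\in L'(v)$, $c_uc_v$ is an edge of ${\rm DSG}(K_6,M)$ with $m^*(c_uc_v)=\sigma(uv)$.
   Context: Let $C=\{i^+,i^-:1\le i\le 6\}$ be the vertex set of ${\rm DSG}(K_6,M)$ with signature $m^*$: for $i\ne j$ and $\alpha\in\{+,-\}$, $i^\alpha j^\alpha$ is an edge, negative if $\{i,j\}\in\{\{1,2\},\{3,4\},\{5,6\}\}$ and positive otherwise; $i^\alpha j^{ -\alpha}$ is an edge, positive if $\{i,j\}\in\{\{1,2\},\{3,4\},\{5,6\}\}$ and negative otherwise; $i^+,i^-$ are non-adjacent. $C^+=\{i^+\}$, $C^-=\{i^-\}$. The pair of $(2l-1)^\alpha$ is $(2l)^\alpha$ and vice versa; a layer is $\{(2l-1)^+,(2l)^+,(2l-1)^-,(2l)^-\}$, $l=1,2,3$. A neighbored $5$-set is a set of $5$ elements of $C$, no three in a common layer, consisting of two pairs contained in one of $C^+,C^-$ together with a single element of the other. A signed edge $uv$ carries a sign $\sigma(uv)\in\{+,-\}$. -}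

module Defs where

open import Data.Fin using (Fin; zero; suc)
open import Data.Nat using (ℕ)
open import Data.Product using (Σ; _×_; _,_; proj₁; proj₂; ∃-syntax)
open import Data.Sum using (_⊎_)
open import Data.List using (List; length)
open import Data.List.Membership.Propositional using (_∈_)
open import Data.List.Relation.Unary.Unique.Propositional using (Unique)
open import Relation.Binary.PropositionalEquality using (_≡_; _≢_)
open import Relation.Nullary using (¬_)
open import Function.Bundles using (_⇔_)

-- Signs (used both for the superscript α ∈ {+,-} and for edge signs).
data Sign : Set where
  plus minus : Sign

neg : Sign → Sign
neg plus  = minus
neg minus = plus

-- Colours i^α, with i ∈ {1..6} encoded as Fin 6 (0-indexed: index k stands for k+1).
Color : Set
Color = Fin 6 × Sign

index : Color → Fin 6
index = proj₁

sgn : Color → Sign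
sgn = proj₂

layerIdx : Fin 6 → Fin 3
layerIdx zero                                = zero
layerIdx (suc zero)                          = zero
layerIdx (suc (suc zero))                    = suc zero
layerIdx (suc (suc (suc zero)))              = suc zero
layerIdx (suc (suc (suc (suc zero))))        = suc (suc zero)
layerIdx (suc (suc (suc (suc (suc zero))))) = suc (suc zero)

layer : Color → Fin 3
layer c = layerIdx (index c)

partnerIdx : Fin 6 → Fin 6
partnerIdx zero                                = suc zero
partnerIdx (suc zero)                          = zero
partnerIdx (suc (suc zero))                    = suc (suc (suc zero))
partnerIdx (suc (suc (suc zero)))              = suc (suc zero)
partnerIdx (suc (suc (suc (suc zero))))        = suc (suc (suc (suc (suc zero))))
partnerIdx (suc (suc (suc (suc (suc zero))))) = suc (suc (suc (suc zero)))

pairOf : Color → Color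
pairOf (i , α) = (partnerIdx i , α)

-- Is {i,j} ∈ M = {{1,2},{3,4},{5,6}} (for i ≠ j): same layer
inM : Fin 6 → Fin 6 → Sign
inM i j = helper (layerIdx i) (layerIdx j)
  where
  helper : Fin 3 → Fin 3 → Sign   -- plus = "in M", minus = "not in M"
  helper zero zero = plus
  helper (suc zero) (suc zero) = plus
  helper (suc (suc zero)) (suc (suc zero)) = plus
  helper _ _ = minus

sameSign : Sign → Sign → Sign
sameSign plus  plus  = plus
sameSign minus minus = plus
sameSign _     _     = minus

Edge : Color → Color → Set
Edge x y = index x ≢ index y

-- The signature m*: for same superscripts, negative iff {i,j} ∈ M;
-- for opposite superscripts, positive iff {i,j} ∈ M.
mstar : Color → Color → Sign
mstar x y with sameSign (sgn x) (sgn y) | inM (index x) (index y)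
... | plus  | plus  = minus
... | plus  | minus = plus
... | minus | plus  = plus
... | minus | minus = minus

-- Finite sets of colours are represented as duplicate-free lists.
-- A neighbored 5-set.
NoThreeInLayer : List Color → Set
NoThreeInLayer S =
  ¬ (Σ Color λ x → Σ Color λ y → Σ Color λ z →
       x ∈ S × y ∈ S × z ∈ S × x ≢ y × y ≢ z × x ≢ z ×
       layer x ≡ layer y × layer y ≡ layer z)

Neighbored5 : List Color → Set
Neighbored5 S =
  Unique S × length S ≡ 5 × NoThreeInLayer S ×
  (Σ Sign λ α → Σ Color λ a → Σ Color λ b → Σ Color λ c →
     sgn a ≡ α × sgn b ≡ α × sgn c ≡ neg α ×
     (∀ x → (x ∈ S) ⇔ (x ≡ a ⊎ x ≡ pairOf a ⊎ x ≡ b ⊎ x ≡ pairOf b ⊎ x ≡ c)))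

IsHalf : List Color → Set
IsHalf S = Σ Sign λ α → ∀ x → (x ∈ S) ⇔ (sgn x ≡ α)

-- Every edge between two different layers has sign +1 if its ends have equal
-- superscripts and −1 otherwise.  So a colour c = i^γ is joined to the four
-- colours of C^β outside the layer of i by edges of one and the same sign,
-- and this sign flips with γ.  A neighbored 5-set contains colours of both
-- superscripts, so one of them, c_u, yields the required sign σ(uv).

module Submission where

open import Defs
open import Data.Fin using (Fin; zero; suc)
open import Data.Product using (Σ; _×_; _,_; proj₁)
open import Data.Sum using (_⊎_; inj₁; inj₂)
open import Data.List using (List; length; _∷_; [])
open import Data.List.Membership.Propositional using (_∈_)
open import Data.List.Relation.Unary.All as All using (All; _∷_; [])
open import Data.List.Relation.Unary.AllPairs using (_∷_; [])
open import Data.List.Relation.Unary.Unique.Propositional using (Unique)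
open import Relation.Binary.PropositionalEquality using (_≡_; _≢_; refl; trans; subst)
open import Function.Bundles using (_⇔_; Equivalence)

pattern f0 = zero
pattern f1 = suc zero
pattern f2 = suc (suc zero)
pattern f3 = suc (suc (suc zero))
pattern f4 = suc (suc (suc (suc zero)))
pattern f5 = suc (suc (suc (suc (suc zero))))

sameSign-negˡ : ∀ γ β → sameSign (neg γ) β ≡ neg (sameSign γ β)
sameSign-negˡ plus  plus  = refl
sameSign-negˡ plus  minus = refl
sameSign-negˡ minus plus  = refl
sameSign-negˡ minus minus = refl

≡⊎neg≡ : ∀ s σ → s ≡ σ ⊎ neg s ≡ σ
≡⊎neg≡ plus  plus  = inj₁ refl
≡⊎neg≡ plus  minus = inj₂ refl
≡⊎neg≡ minus plus  = inj₂ refl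
≡⊎neg≡ minus minus = inj₁ refl

mstar-offM : ∀ i j γ β → inM i j ≡ minus → mstar (i , γ) (j , β) ≡ sameSign γ β
mstar-offM i j γ β i∉M rewrite i∉M with sameSign γ β
... | plus  = refl
... | minus = refl

offLayer : Fin 3 → Sign → List Color
offLayer zero             β = (f2 , β) ∷ (f3 , β) ∷ (f4 , β) ∷ (f5 , β) ∷ []
offLayer (suc zero)       β = (f0 , β) ∷ (f1 , β) ∷ (f4 , β) ∷ (f5 , β) ∷ []
offLayer (suc (suc zero)) β = (f0 , β) ∷ (f1 , β) ∷ (f2 , β) ∷ (f3 , β) ∷ []

offLayer-unique : ∀ l β → Unique (offLayer l β)
offLayer-unique zero             β =
  ((λ ()) ∷ (λ ()) ∷ (λ ()) ∷ []) ∷ ((λ ()) ∷ (λ ()) ∷ []) ∷ ((λ ()) ∷ []) ∷ [] ∷ []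
offLayer-unique (suc zero)       β =
  ((λ ()) ∷ (λ ()) ∷ (λ ()) ∷ []) ∷ ((λ ()) ∷ (λ ()) ∷ []) ∷ ((λ ()) ∷ []) ∷ [] ∷ []
offLayer-unique (suc (suc zero)) β =
  ((λ ()) ∷ (λ ()) ∷ (λ ()) ∷ []) ∷ ((λ ()) ∷ (λ ()) ∷ []) ∷ ((λ ()) ∷ []) ∷ [] ∷ []

offLayer-length : ∀ l β → length (offLayer l β) ≡ 4
offLayer-length zero             β = refl
offLayer-length (suc zero)       β = refl
offLayer-length (suc (suc zero)) β = refl

OffM : Fin 6 → Sign → Color → Set
OffM i β x = sgn x ≡ β × i ≢ index x × inM i (index x) ≡ minus

offLayer-offM : ∀ i β → All (OffM i β) (offLayer (layerIdx i) β)
offLayer-offM f0 β = (refl , (λ ()) , refl) ∷ (refl , (λ ()) , refl)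
                     ∷ (refl , (λ ()) , refl) ∷ (refl , (λ ()) , refl) ∷ []
offLayer-offM f1 β = (refl , (λ ()) , refl) ∷ (refl , (λ ()) , refl)
                     ∷ (refl , (λ ()) , refl) ∷ (refl , (λ ()) , refl) ∷ []
offLayer-offM f2 β = (refl , (λ ()) , refl) ∷ (refl , (λ ()) , refl)
                     ∷ (refl , (λ ()) , refl) ∷ (refl , (λ ()) , refl) ∷ []
offLayer-offM f3 β = (refl , (λ ()) , refl) ∷ (refl , (λ ()) , refl)
                     ∷ (refl , (λ ()) , refl) ∷ (refl , (λ ()) , refl) ∷ []
offLayer-offM f4 β = (refl , (λ ()) , refl) ∷ (refl , (λ ()) , refl)
                     ∷ (refl , (λ ()) , refl) ∷ (refl , (λ ()) , refl) ∷ []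
offLayer-offM f5 β = (refl , (λ ()) , refl) ∷ (refl , (λ ()) , refl)
                     ∷ (refl , (λ ()) , refl) ∷ (refl , (λ ()) , refl) ∷ []

edge-offM : ∀ {i β} γ x → OffM i β x → Edge (i , γ) x × mstar (i , γ) x ≡ sameSign γ β
edge-offM {i} {β} γ (j , .β) (refl , i≢j , i∉M) = i≢j , mstar-offM i j γ β i∉M

UniformStar : Color → List Color → Sign → Set
UniformStar c Lv σ = Σ (List Color) λ L' →
  Unique L' × length L' ≡ 4 × (∀ x → x ∈ L' → x ∈ Lv) ×
  (∀ x → x ∈ L' → Edge c x × mstar c x ≡ σ)

uniformStar-half : ∀ c β {Lv} → (∀ x → (x ∈ Lv) ⇔ (sgn x ≡ β)) →
  UniformStar c Lv (sameSign (sgn c) β)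
uniformStar-half (i , γ) β Lv⇔Cβ =
  offLayer (layerIdx i) β , offLayer-unique (layerIdx i) β , offLayer-length (layerIdx i) β ,
  (λ x x∈ → Equivalence.from (Lv⇔Cβ x) (proj₁ (offM x∈))) ,
  (λ x x∈ → edge-offM γ x (offM x∈))
  where
  offM : ∀ {x} → x ∈ offLayer (layerIdx i) β → OffM i β x
  offM = All.lookup (offLayer-offM i β)

lemma4p6 : (σ : Sign) (Lu Lv : List Color) → Neighbored5 Lu → IsHalf Lv →
    Σ Color λ cu → cu ∈ Lu × (Σ (List Color) λ L' →
    Unique L' × length L' ≡ 4 × (∀ x → x ∈ L' → x ∈ Lv) ×
    (∀ cv → cv ∈ L' → Edge cu cv × mstar cu cv ≡ σ))
lemma4p6 σ Lu Lv (_ , _ , _ , α , (i , .α) , _ , (k , .(neg α)) , refl , _ , refl , Lu⇔) (β , Lv⇔Cβ)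
  with ≡⊎neg≡ (sameSign α β) σ
... | inj₁ eq = (i , α) , Equivalence.from (Lu⇔ (i , α)) (inj₁ refl) ,
  subst (UniformStar (i , α) Lv) eq (uniformStar-half (i , α) β Lv⇔Cβ)
... | inj₂ eq = (k , neg α) , Equivalence.from (Lu⇔ (k , neg α)) (inj₂ (inj₂ (inj₂ (inj₂ refl)))) ,
  subst (UniformStar (k , neg α) Lv) (trans (sameSign-negˡ α β) eq)
    (uniformStar-half (k , neg α) β Lv⇔Cβ)
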